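{- Let $\alpha\in(0,1/10]$ and $\beta\in(0,1)$. There exists a constant $\delta>0$ (depending only on $\alpha,\beta$) such that for every set $S\subseteq\mathcal{S}_d$ of $n$ rankings for which the set $A$ of active symbols satisfies $|A|\ge\beta\cdot\mathrm{OPT}/n$, there exists a ranking $\tilde{\sigma}\in S_f$ with $\sum_{\pi\in S}\mathcal{U}(\pi,\tilde{\sigma})\le(3-\delta)\,\mathrm{OPT}$.
   Context: Candidates $[d]$ are partitioned into groups $G_1,\dots,G_g$ with fairness parameters $(\lambda_i),(\mu_i)\in[0,1]^g$, $k\in[d]$; a ranking is fair if every prefix $P$ with $|P|\ge k$ satisfies $\lfloor\lambda_i|P|\rfloor\le|P\cap G_i|\le\lceil\mu_i|P|\rceil$ for all $i$ (a fair ranking is assumed to exist). Ulam distance $\mathcal{U}(\pi_1,\pi_2)=d-|\mathrm{LCS}(\pi_1,\pi_2)|$. $S_f$ is the set of all rankings $\sigma$ such that, for some $\pi\in S$, $\sigma$ is a fair ranking closest to $\pi$ under $\mathcal{U}$. Let $\sigma^*$ be an arbitrary fair median: a fair ranking minimizing $\sum_{\pi\in S}\mathcal{U}(\pi,\sigma^*)$, and $\mathrm{OPT}$ this minimum. For each $\pi\in S$ fix an arbitrary LCS $\ell_\pi$ of $\pi$ and $\sigma^*$. For $a\in[d]$, $\mathrm{cost}(a)=|\{\pi\in S: a\notin\ell_\pi\}|$; $a$ is active if $\mathrm{cost}(a)>\alpha n$; $A$ is the set of active symbols.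
   Formalization: The parameters α, β and the fairness parameters λ_i, μ_i are taken in the rationals. -}

module Defs where

open import Data.Nat as ℕ using (ℕ; zero; suc; _≤_; _⊔_)
open import Data.Fin as Fin using (Fin)
open import Data.Fin.Properties using () renaming (_≟_ to _≟ᶠ_)
open import Data.Integer as ℤ using (ℤ; +_)
open import Data.Rational as ℚ using (ℚ; floor; ceiling)
open import Data.List as List using (List; []; _∷_; length; take; filter; allFin; map; foldr; _++_)
open import Data.Nat.ListAction using (sum)
open import Data.List.Relation.Binary.Permutation.Propositional using (_↭_)
open import Data.List.Relation.Binary.Sublist.Propositional using (_⊆_)
import Data.List.Relation.Binary.Sublist.DecPropositional as DecSub
open import Data.List.Membership.Propositional using (_∈_)
open import Data.Product using (_×_; Σ; ∃; ∃-syntax)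
open import Relation.Binary.PropositionalEquality using (_≡_)

ℕ→ℚ : ℕ → ℚ
ℕ→ℚ n = (+ n) ℚ./ 1

-- A ranking of the candidates [d] = Fin d: a list listing every candidate exactly once
-- (position 0 = top).
IsRanking : (d : ℕ) → List (Fin d) → Set
IsRanking d π = π ↭ allFin d

IsCommonSubseq : ∀ {d} → List (Fin d) → List (Fin d) → List (Fin d) → Set
IsCommonSubseq l π₁ π₂ = (l ⊆ π₁) × (l ⊆ π₂)

IsLCS : ∀ {d} → List (Fin d) → List (Fin d) → List (Fin d) → Set
IsLCS l π₁ π₂ = IsCommonSubseq l π₁ π₂ × (∀ l′ → IsCommonSubseq l′ π₁ π₂ → length l′ ≤ length l)

subseqs : ∀ {A : Set} → List A → List (List A)
subseqs [] = [] ∷ []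
subseqs (x ∷ xs) = map (x ∷_) (subseqs xs) ++ subseqs xs

lcsLength : ∀ {d} → List (Fin d) → List (Fin d) → ℕ
lcsLength {d} π₁ π₂ = foldr _⊔_ 0 (map length (filter (λ l → DecSub._⊆?_ (_≟ᶠ_ {d}) l π₂) (subseqs π₁)))

ulam : (d : ℕ) → List (Fin d) → List (Fin d) → ℕ
ulam d π₁ π₂ = d ℕ.∸ lcsLength π₁ π₂

totalCost : (d : ℕ) → List (List (Fin d)) → List (Fin d) → ℕ
totalCost d S σ = sum (map (λ π → ulam d π σ) S)

countGroup : ∀ {d g} → (Fin d → Fin g) → Fin g → List (Fin d) → ℕ
countGroup grp i P = length (filter (λ a → grp a ≟ᶠ i) P)

IsFair : (d g : ℕ) → (Fin d → Fin g) → (Fin g → ℚ) → (Fin g → ℚ) → ℕ → List (Fin d) → Set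
IsFair d g grp lam mu k σ =
  IsRanking d σ ×
  (∀ (p : ℕ) → k ≤ p → p ≤ d → ∀ (i : Fin g) →
     (floor (lam i ℚ.* ℕ→ℚ p) ℤ.≤ + countGroup grp i (take p σ)) ×
     (+ countGroup grp i (take p σ) ℤ.≤ ceiling (mu i ℚ.* ℕ→ℚ p)))

IsClosestFair : (d g : ℕ) → (Fin d → Fin g) → (Fin g → ℚ) → (Fin g → ℚ) → ℕ →
                List (Fin d) → List (Fin d) → Set
IsClosestFair d g grp lam mu k π σ =
  IsFair d g grp lam mu k σ × (∀ τ → IsFair d g grp lam mu k τ → ulam d π σ ≤ ulam d π τ)

InSf : (d g : ℕ) → (Fin d → Fin g) → (Fin g → ℚ) → (Fin g → ℚ) → ℕ →
       List (List (Fin d)) → List (Fin d) → Set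
InSf d g grp lam mu k S σ = ∃[ π ] (π ∈ S × IsClosestFair d g grp lam mu k π σ)

IsFairMedian : (d g : ℕ) → (Fin d → Fin g) → (Fin g → ℚ) → (Fin g → ℚ) → ℕ →
               List (List (Fin d)) → List (Fin d) → Set
IsFairMedian d g grp lam mu k S σ =
  IsFair d g grp lam mu k σ × (∀ τ → IsFair d g grp lam mu k τ → totalCost d S σ ≤ totalCost d S τ)

symCost : ∀ {d} → List (List (Fin d)) → (List (Fin d) → List (Fin d)) → Fin d → ℕ
symCost {d} S ℓ a = length (filter (λ π → Relation.Nullary.¬? (Data.List.Membership.DecPropositional._∈?_ (_≟ᶠ_ {d}) a (ℓ π))) S)
  where import Relation.Nullary
        import Data.List.Membership.DecPropositional

activeSymbols : (d : ℕ) → ℚ → List (List (Fin d)) → (List (Fin d) → List (Fin d)) → List (Fin d)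
activeSymbols d α S ℓ = filter (λ a → (α ℚ.* ℕ→ℚ (length S)) ℚ.<? ℕ→ℚ (symCost S ℓ a)) (allFin d)

{-# OPTIONS --safe #-}
module Submission where

-- For π ∈ S let σᶠ(π) be a fair ranking closest to π. As σ* is fair, U(π′, σᶠ(π)) ≤ U(π′, π) + U(π, σ*).
-- Intersecting the fixed LCSs ℓ_π′ and ℓ_π inside σ* gives a common subsequence of π′ and π, whence
-- U(π′, π) + |{a : a ∉ ℓ_π′, a ∉ ℓ_π}| ≤ U(π′, σ*) + U(π, σ*). Summing over all pairs (π′, π) and
-- writing C(σ) = ∑_{π′ ∈ S} U(π′, σ), we get ∑_π C(σᶠ(π)) + ∑_a cost(a)² ≤ 3n·OPT, where every active
-- symbol contributes more than (αn)² to the second sum. So the cheapest σᶠ(π) has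
-- C(σᶠ(π)) ≤ 3·OPT − |A|α²n ≤ (3 − α²β)·OPT, i.e. δ = α²β.

open import Defs
open import Data.Bool using (Bool; true; false; not; _∧_)
open import Data.Nat as ℕ using (ℕ; zero; suc; _+_; _*_; _∸_; _≤_; _<_; _⊔_; z≤n; s≤s)
open import Data.Nat.Properties as ℕ
  using (≤-trans; ≤-reflexive; +-mono-≤; +-monoʳ-≤; +-cancelʳ-≤; m∸n+n≡m; m≤m⊔n; m≤n⊔m; ⊔-sel)
open import Algebra.Properties.CommutativeSemigroup ℕ.+-commutativeSemigroup using (interchange; xy∙z≈xz∙y)
open import Data.Nat.ListAction using (sum)
open import Data.Nat.ListAction.Properties using (sum-↭)
open import Data.Nat.Tactic.RingSolver using (solve-∀)
open import Data.Nat.Coprimality using (1-coprimeTo) renaming (sym to coprime-sym)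
open import Data.Integer as ℤ using (+_; +≤+)
import Data.Integer.Properties as ℤ
open import Data.Rational as ℚ using (ℚ; mkℚ; 0ℚ; 1ℚ; floor; ceiling; Positive)
import Data.Rational.Properties as ℚ
open import Data.Rational.Solver using (module +-*-Solver)
open import Data.Fin using (Fin)
open import Data.Fin.Properties using (all?) renaming (_≟_ to _≟ᶠ_)
open import Data.List using (List; []; _∷_; length; map; filter; foldr; take; allFin; cartesianProductWith)
open import Data.List.Properties using (filter-accept; filter-reject; length-tabulate)
open import Data.List.Extrema.Nat using (argmin; argmin-sel; argmin-all; f[argmin]≤f[⊤]; f[argmin]≤f[xs])
open import Data.List.Membership.Propositional using (_∈_)
open import Data.List.Membership.Propositional.Properties
  using (∈-map⁺; ∈-map⁻; ∈-++⁺ˡ; ∈-++⁺ʳ; ∈-++⁻; ∈-map∘filter⁺; ∈-map∘filter⁻; foldr-selective;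
         ∈-allFin; ∈-filter⁺; ∈-cartesianProductWith⁺)
open import Data.List.Membership.Propositional.Properties.WithK using (unique∧set⇒bag)
import Data.List.Membership.DecPropositional as DecMembership
open import Data.List.Relation.Unary.Any using (here; there)
open import Data.List.Relation.Unary.All as All using (All; _∷_)
open import Data.List.Relation.Unary.All.Properties using (all-filter)
open import Data.List.Relation.Unary.AllPairs using (_∷_)
open import Data.List.Relation.Unary.Unique.Propositional using (Unique)
open import Data.List.Relation.Unary.Unique.Propositional.Properties using (allFin⁺)
open import Data.List.Relation.Unary.Unique.DecPropositional using (unique?)
open import Data.List.Relation.Binary.Sublist.Propositional
  using (_⊆_; []; _∷_; _∷ʳ_; ⊆-refl; ⊆-trans; minimum) renaming (lookup to ⊆-lookup)
open import Data.List.Relation.Binary.Sublist.Propositional.Properties using (length-mono-≤; filter⁺)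
import Data.List.Relation.Binary.Sublist.DecPropositional as DecSublist
open import Data.List.Relation.Binary.Permutation.Propositional using (_↭_; ↭-sym; ↭⇒↭ₛ)
open import Data.List.Relation.Binary.Permutation.Propositional.Properties using (↭-length; map⁺; ∈-resp-↭)
import Data.List.Relation.Binary.Permutation.Setoid.Properties as PermutationSetoid
open import Data.List.Relation.Binary.BagAndSetEquality using (∼bag⇒↭)
open import Data.Product using (_×_; _,_; ∃-syntax; proj₁; proj₂; swap)
open import Data.Sum using (inj₁; inj₂; [_,_]′)
open import Function using (_∘_; const; id)
open import Function.Bundles using (mk⇔)
open import Relation.Binary.Definitions using (DecidableEquality)
open import Relation.Binary.PropositionalEquality
open import Relation.Nullary using (Dec; yes; no; does; ¬?; contradiction)
open import Relation.Nullary.Decidable using (_×-dec_; _→-dec_; map′)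
open import Relation.Unary using (Pred; Decidable)
open import Level using (0ℓ)

module _ {A : Set} where

  ∑ : List A → (A → ℕ) → ℕ
  ∑ xs f = sum (map f xs)

  ∑-cong : ∀ xs {f g : A → ℕ} → f ≗ g → ∑ xs f ≡ ∑ xs g
  ∑-cong [] f≗g = refl
  ∑-cong (x ∷ xs) f≗g = cong₂ _+_ (f≗g x) (∑-cong xs f≗g)

  ∑-mono-≤ : ∀ xs {f g : A → ℕ} → (∀ {x} → x ∈ xs → f x ≤ g x) → ∑ xs f ≤ ∑ xs g
  ∑-mono-≤ [] f≤g = z≤n
  ∑-mono-≤ (x ∷ xs) f≤g = +-mono-≤ (f≤g (here refl)) (∑-mono-≤ xs (f≤g ∘ there))

  ∑-distrib-+ : ∀ xs (f g : A → ℕ) → ∑ xs (λ x → f x + g x) ≡ ∑ xs f + ∑ xs g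
  ∑-distrib-+ [] f g = refl
  ∑-distrib-+ (x ∷ xs) f g =
    trans (cong (_+_ (f x + g x)) (∑-distrib-+ xs f g)) (interchange (f x) (g x) _ _)

  ∑-const : ∀ xs c → ∑ xs (const c) ≡ length xs * c
  ∑-const [] c = refl
  ∑-const (x ∷ xs) c = cong (_+_ c) (∑-const xs c)

  ∑-*ˡ : ∀ xs c (f : A → ℕ) → ∑ xs (λ x → c * f x) ≡ c * ∑ xs f
  ∑-*ˡ [] c f = sym (ℕ.*-zeroʳ c)
  ∑-*ˡ (x ∷ xs) c f = trans (cong (_+_ (c * f x)) (∑-*ˡ xs c f)) (sym (ℕ.*-distribˡ-+ c (f x) (∑ xs f)))

  ∑-*ʳ : ∀ xs c (f : A → ℕ) → ∑ xs (λ x → f x * c) ≡ ∑ xs f * c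
  ∑-*ʳ xs c f = begin
    ∑ xs (λ x → f x * c) ≡⟨ ∑-cong xs (λ x → ℕ.*-comm (f x) c) ⟩
    ∑ xs (λ x → c * f x) ≡⟨ ∑-*ˡ xs c f ⟩
    c * ∑ xs f           ≡⟨ ℕ.*-comm c (∑ xs f) ⟩
    ∑ xs f * c           ∎
    where open ≡-Reasoning

  ∑-↭ : ∀ {xs ys} (f : A → ℕ) → xs ↭ ys → ∑ xs f ≡ ∑ ys f
  ∑-↭ f xs↭ys = sum-↭ (map⁺ f xs↭ys)

module _ {A B : Set} where

  ∑-comm : ∀ xs ys (h : A → B → ℕ) → ∑ xs (λ x → ∑ ys (h x)) ≡ ∑ ys (λ y → ∑ xs (λ x → h x y))
  ∑-comm [] ys h = sym (trans (∑-const ys 0) (ℕ.*-zeroʳ (length ys)))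
  ∑-comm (x ∷ xs) ys h = trans (cong (_+_ (∑ ys (h x))) (∑-comm xs ys h)) (sym (∑-distrib-+ ys (h x) _))

  ∑∑∑≡∑-square : ∀ xs zs (f : B → A → ℕ) →
    ∑ xs (λ x → ∑ xs (λ y → ∑ zs (λ z → f z y * f z x))) ≡ ∑ zs (λ z → ∑ xs (f z) * ∑ xs (f z))
  ∑∑∑≡∑-square xs zs f = begin
    ∑ xs (λ x → ∑ xs (λ y → ∑ zs (λ z → f z y * f z x)))
      ≡⟨ ∑-cong xs (λ x → ∑-comm xs zs (λ y z → f z y * f z x)) ⟩
    ∑ xs (λ x → ∑ zs (λ z → ∑ xs (λ y → f z y * f z x)))
      ≡⟨ ∑-comm xs zs (λ x z → ∑ xs (λ y → f z y * f z x)) ⟩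
    ∑ zs (λ z → ∑ xs (λ x → ∑ xs (λ y → f z y * f z x)))
      ≡⟨ ∑-cong zs (λ z → ∑-cong xs (λ x → ∑-*ʳ xs (f z x) (f z))) ⟩
    ∑ zs (λ z → ∑ xs (λ x → ∑ xs (f z) * f z x))
      ≡⟨ ∑-cong zs (λ z → ∑-*ˡ xs (∑ xs (f z)) (f z)) ⟩
    ∑ zs (λ z → ∑ xs (f z) * ∑ xs (f z)) ∎
    where open ≡-Reasoning

private
  triple : ∀ m → m + m + m ≡ 3 * m
  triple = solve-∀

∑∑[fy+fx+fx]≡3n∑f : ∀ {A : Set} xs (f : A → ℕ) →
  ∑ xs (λ x → ∑ xs (λ y → f y + f x + f x)) ≡ 3 * (length xs * ∑ xs f)
∑∑[fy+fx+fx]≡3n∑f xs f = begin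
  ∑ xs (λ x → ∑ xs (λ y → f y + f x + f x))
    ≡⟨ ∑-cong xs (λ x → trans (∑-distrib-+ xs (λ y → f y + f x) (λ _ → f x))
                              (cong₂ _+_ (∑-distrib-+ xs f (λ _ → f x)) (∑-const xs (f x)))) ⟩
  ∑ xs (λ x → ∑ xs f + ∑ xs (λ _ → f x) + n * f x)
    ≡⟨ ∑-cong xs (λ x → cong (λ t → ∑ xs f + t + n * f x) (∑-const xs (f x))) ⟩
  ∑ xs (λ x → ∑ xs f + n * f x + n * f x)
    ≡⟨ ∑-distrib-+ xs (λ x → ∑ xs f + n * f x) (λ x → n * f x) ⟩
  ∑ xs (λ x → ∑ xs f + n * f x) + ∑ xs (λ x → n * f x)
    ≡⟨ cong₂ _+_ (trans (∑-distrib-+ xs (λ _ → ∑ xs f) (λ x → n * f x))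
                        (cong₂ _+_ (∑-const xs (∑ xs f)) (∑-*ˡ xs n f)))
                 (∑-*ˡ xs n f) ⟩
  n * ∑ xs f + n * ∑ xs f + n * ∑ xs f
    ≡⟨ triple (n * ∑ xs f) ⟩
  3 * (n * ∑ xs f) ∎
  where
  open ≡-Reasoning
  n = length xs

min≤mean : ∀ {A : Set} (f : A → ℕ) xs → 1 ≤ length xs → ∃[ x ] (x ∈ xs × length xs * f x ≤ ∑ xs f)
min≤mean f (x₀ ∷ xs) _ = m , m∈ , (begin
  length (x₀ ∷ xs) * f m ≡⟨ ∑-const (x₀ ∷ xs) (f m) ⟨
  ∑ (x₀ ∷ xs) (const (f m)) ≤⟨ ∑-mono-≤ (x₀ ∷ xs) (All.lookup m≤) ⟩
  ∑ (x₀ ∷ xs) f ∎)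
  where
  open ℕ.≤-Reasoning
  m = argmin f x₀ xs
  m∈ : m ∈ x₀ ∷ xs
  m∈ = [ here , there ]′ (argmin-sel f x₀ xs)
  m≤ : All (λ y → f m ≤ f y) (x₀ ∷ xs)
  m≤ = f[argmin]≤f[⊤] {f = f} x₀ xs ∷ f[argmin]≤f[xs] {f = f} x₀ xs

𝟙 : Bool → ℕ
𝟙 true = 1
𝟙 false = 0

length-filter≡∑𝟙 : ∀ {A : Set} {P : Pred A 0ℓ} (P? : Decidable P) xs →
  length (filter P? xs) ≡ ∑ xs (λ x → 𝟙 (does (P? x)))
length-filter≡∑𝟙 P? [] = refl
length-filter≡∑𝟙 P? (x ∷ xs) with does (P? x)
... | true = cong suc (length-filter≡∑𝟙 P? xs)
... | false = length-filter≡∑𝟙 P? xs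

module _ {A : Set} where

  ⊆⇒∈-subseqs : ∀ {l xs : List A} → l ⊆ xs → l ∈ subseqs xs
  ⊆⇒∈-subseqs [] = here refl
  ⊆⇒∈-subseqs (y ∷ʳ l⊆xs) = ∈-++⁺ʳ (map (y ∷_) _) (⊆⇒∈-subseqs l⊆xs)
  ⊆⇒∈-subseqs (refl ∷ l⊆xs) = ∈-++⁺ˡ (∈-map⁺ (_ ∷_) (⊆⇒∈-subseqs l⊆xs))

  ∈-subseqs⇒⊆ : ∀ {l} (xs : List A) → l ∈ subseqs xs → l ⊆ xs
  ∈-subseqs⇒⊆ [] (here refl) = []
  ∈-subseqs⇒⊆ (x ∷ xs) l∈ with ∈-++⁻ (map (x ∷_) (subseqs xs)) l∈
  ... | inj₂ l∈′ = x ∷ʳ ∈-subseqs⇒⊆ xs l∈′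
  ... | inj₁ l∈′ with ∈-map⁻ (x ∷_) l∈′
  ...   | _ , l′∈ , refl = refl ∷ ∈-subseqs⇒⊆ xs l′∈

∈⇒≤-foldr-⊔ : ∀ {x} xs → x ∈ xs → x ≤ foldr _⊔_ 0 xs
∈⇒≤-foldr-⊔ (y ∷ ys) (here refl) = m≤m⊔n y _
∈⇒≤-foldr-⊔ (y ∷ ys) (there x∈) = ≤-trans (∈⇒≤-foldr-⊔ ys x∈) (m≤n⊔m y _)

module _ {d : ℕ} where

  private
    _⊆?_ : (l π : List (Fin d)) → Dec (l ⊆ π)
    _⊆?_ = DecSublist._⊆?_ _≟ᶠ_

    common? : (π₂ : List (Fin d)) → Decidable (_⊆ π₂)
    common? π₂ l = l ⊆? π₂

  common⇒≤lcsLength : ∀ {l π₁ π₂ : List (Fin d)} → IsCommonSubseq l π₁ π₂ → length l ≤ lcsLength π₁ π₂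
  common⇒≤lcsLength {π₂ = π₂} (l⊆π₁ , l⊆π₂) =
    ∈⇒≤-foldr-⊔ _ (∈-map∘filter⁺ length (common? π₂) (_ , ⊆⇒∈-subseqs l⊆π₁ , refl , l⊆π₂))

  lcsLength-attained : ∀ (π₁ π₂ : List (Fin d)) →
    ∃[ l ] (IsCommonSubseq l π₁ π₂ × length l ≡ lcsLength π₁ π₂)
  lcsLength-attained π₁ π₂ with foldr-selective ⊔-sel 0 (map length (filter (common? π₂) (subseqs π₁)))
  ... | inj₁ lcs≡0 = [] , (minimum π₁ , minimum π₂) , sym lcs≡0
  ... | inj₂ lcs∈ with ∈-map∘filter⁻ length (common? π₂) lcs∈
  ...   | l , l∈ , lcs≡ , l⊆π₂ = l , (∈-subseqs⇒⊆ π₁ l∈ , l⊆π₂) , sym lcs≡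

  IsLCS⇒length≡lcsLength : ∀ {l π₁ π₂ : List (Fin d)} → IsLCS l π₁ π₂ → length l ≡ lcsLength π₁ π₂
  IsLCS⇒length≡lcsLength {π₁ = π₁} {π₂} (common , maximal) with lcsLength-attained π₁ π₂
  ... | l′ , common′ , l′≡ = ℕ.≤-antisym (common⇒≤lcsLength common) (subst (_≤ _) l′≡ (maximal l′ common′))

  lcsLength≤length : ∀ (π₁ π₂ : List (Fin d)) → lcsLength π₁ π₂ ≤ length π₁
  lcsLength≤length π₁ π₂ with lcsLength-attained π₁ π₂
  ... | l , (l⊆π₁ , _) , l≡ = subst (_≤ length π₁) l≡ (length-mono-≤ l⊆π₁)

module _ {d : ℕ} {π : List (Fin d)} (π-ranking : IsRanking d π) where

  ranking⇒unique : Unique π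
  ranking⇒unique = PermutationSetoid.Unique-resp-↭ (setoid _) (↭⇒↭ₛ (↭-sym π-ranking)) (allFin⁺ d)

  ranking⇒length≡ : length π ≡ d
  ranking⇒length≡ = trans (↭-length π-ranking) (length-tabulate id)

  ⊆-ranking⇒length≤ : ∀ {l} → l ⊆ π → length l ≤ d
  ⊆-ranking⇒length≤ {l} l⊆π = subst (length l ≤_) ranking⇒length≡ (length-mono-≤ l⊆π)

module _ {A : Set} {P : Pred A 0ℓ} (P? : Decidable P) where

  filter≡sublist : ∀ {l ρ} → Unique ρ → l ⊆ ρ →
    (∀ {a} → a ∈ ρ → P a → a ∈ l) → (∀ {a} → a ∈ l → P a) → filter P? ρ ≡ l
  filter≡sublist _ [] _ _ = refl
  filter≡sublist (y∉ρ′ ∷ ρ′-unique) (y ∷ʳ l⊆ρ′) P⇒∈ ∈⇒P =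
    trans (filter-reject P? (λ Py → All.lookup y∉ρ′ (⊆-lookup l⊆ρ′ (P⇒∈ (here refl) Py)) refl))
          (filter≡sublist ρ′-unique l⊆ρ′ (P⇒∈ ∘ there) ∈⇒P)
  filter≡sublist {y ∷ l′} {_ ∷ ρ′} (y∉ρ′ ∷ ρ′-unique) (refl ∷ l′⊆ρ′) P⇒∈ ∈⇒P =
    trans (filter-accept P? (∈⇒P (here refl)))
          (cong (y ∷_) (filter≡sublist ρ′-unique l′⊆ρ′ P⇒∈′ (∈⇒P ∘ there)))
    where
    P⇒∈′ : ∀ {a} → a ∈ ρ′ → P a → a ∈ l′
    P⇒∈′ a∈ρ′ Pa with P⇒∈ (there a∈ρ′) Pa
    ... | here refl = contradiction refl (All.lookup y∉ρ′ a∈ρ′)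
    ... | there a∈l′ = a∈l′

module SublistCounting {A : Set} (_≟_ : DecidableEquality A) where

  open DecMembership _≟_ using (_∈?_)

  [_∉_] : A → List A → ℕ
  [ a ∉ l ] = 𝟙 (does (¬? (a ∈? l)))

  length≡∑𝟙∈ : ∀ {l ρ} → Unique ρ → l ⊆ ρ → length l ≡ ∑ ρ (λ a → 𝟙 (does (a ∈? l)))
  length≡∑𝟙∈ {l} {ρ} ρ-unique l⊆ρ = begin
    length l                  ≡⟨ cong length (filter≡sublist (_∈? l) ρ-unique l⊆ρ (λ _ a∈l → a∈l) id) ⟨
    length (filter (_∈? l) ρ) ≡⟨ length-filter≡∑𝟙 (_∈? l) ρ ⟩
    ∑ ρ (λ a → 𝟙 (does (a ∈? l))) ∎
    where open ≡-Reasoning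

  private
    𝟙-inclusion-exclusion : ∀ b₁ b₂ → 𝟙 (b₁ ∧ b₂) + 1 ≡ 𝟙 b₁ + 𝟙 b₂ + 𝟙 (not b₁) * 𝟙 (not b₂)
    𝟙-inclusion-exclusion true true = refl
    𝟙-inclusion-exclusion true false = refl
    𝟙-inclusion-exclusion false true = refl
    𝟙-inclusion-exclusion false false = refl

  common-sublist : ∀ {l₁ l₂ ρ} → Unique ρ → l₁ ⊆ ρ → l₂ ⊆ ρ →
    ∃[ m ] (m ⊆ l₁ × m ⊆ l₂ ×
            length m + length ρ ≡ length l₁ + length l₂ + ∑ ρ (λ a → [ a ∉ l₁ ] * [ a ∉ l₂ ]))
  common-sublist {l₁} {l₂} {ρ} ρ-unique l₁⊆ρ l₂⊆ρ = m , m⊆l₁ , m⊆l₂ , count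
    where
    P? : Decidable (λ a → a ∈ l₁ × a ∈ l₂)
    P? a = (a ∈? l₁) ×-dec (a ∈? l₂)
    m = filter P? ρ
    m⊆l₁ : m ⊆ l₁
    m⊆l₁ = subst (m ⊆_) (filter≡sublist (_∈? l₁) ρ-unique l₁⊆ρ (λ _ a∈l₁ → a∈l₁) id)
                 (filter⁺ P? (_∈? l₁) (λ { refl → proj₁ }) (⊆-refl {x = ρ}))
    m⊆l₂ : m ⊆ l₂
    m⊆l₂ = subst (m ⊆_) (filter≡sublist (_∈? l₂) ρ-unique l₂⊆ρ (λ _ a∈l₂ → a∈l₂) id)
                 (filter⁺ P? (_∈? l₂) (λ { refl → proj₂ }) (⊆-refl {x = ρ}))
    b₁ b₂ : A → Bool
    b₁ a = does (a ∈? l₁)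
    b₂ a = does (a ∈? l₂)
    outside = ∑ ρ (λ a → [ a ∉ l₁ ] * [ a ∉ l₂ ])
    count : length m + length ρ ≡ length l₁ + length l₂ + outside
    count = begin
      length m + length ρ
        ≡⟨ cong₂ _+_ (length-filter≡∑𝟙 P? ρ) (trans (sym (ℕ.*-identityʳ _)) (sym (∑-const ρ 1))) ⟩
      ∑ ρ (λ a → 𝟙 (b₁ a ∧ b₂ a)) + ∑ ρ (const 1)
        ≡⟨ ∑-distrib-+ ρ _ _ ⟨
      ∑ ρ (λ a → 𝟙 (b₁ a ∧ b₂ a) + 1)
        ≡⟨ ∑-cong ρ (λ a → 𝟙-inclusion-exclusion (b₁ a) (b₂ a)) ⟩
      ∑ ρ (λ a → 𝟙 (b₁ a) + 𝟙 (b₂ a) + [ a ∉ l₁ ] * [ a ∉ l₂ ])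
        ≡⟨ ∑-distrib-+ ρ _ _ ⟩
      ∑ ρ (λ a → 𝟙 (b₁ a) + 𝟙 (b₂ a)) + outside
        ≡⟨ cong (_+ outside) (∑-distrib-+ ρ (𝟙 ∘ b₁) (𝟙 ∘ b₂)) ⟩
      ∑ ρ (𝟙 ∘ b₁) + ∑ ρ (𝟙 ∘ b₂) + outside
        ≡⟨ cong (λ n → n + ∑ ρ (𝟙 ∘ b₂) + outside) (length≡∑𝟙∈ ρ-unique l₁⊆ρ) ⟨
      length l₁ + ∑ ρ (𝟙 ∘ b₂) + outside
        ≡⟨ cong (λ n → length l₁ + n + outside) (length≡∑𝟙∈ ρ-unique l₂⊆ρ) ⟨
      length l₁ + length l₂ + outside ∎
      where open ≡-Reasoning

private
  ∸-bound : ∀ {d x y z m c} → x ≤ d → y ≤ d → z ≤ d → m ≤ z → m + d ≡ x + y + c →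
    (d ∸ z) + c ≤ (d ∸ x) + (d ∸ y)
  ∸-bound {d} {x} {y} {z} {m} {c} x≤d y≤d z≤d m≤z m+d≡ = +-cancelʳ-≤ (x + y) _ _ (begin
    (d ∸ z) + c + (x + y)       ≡⟨ ℕ.+-assoc (d ∸ z) c (x + y) ⟩
    (d ∸ z) + (c + (x + y))     ≡⟨ cong (_+_ (d ∸ z)) (trans (ℕ.+-comm c (x + y)) (sym m+d≡)) ⟩
    (d ∸ z) + (m + d)           ≤⟨ +-monoʳ-≤ (d ∸ z) (ℕ.+-monoˡ-≤ d m≤z) ⟩
    (d ∸ z) + (z + d)           ≡⟨ ℕ.+-assoc (d ∸ z) z d ⟨
    (d ∸ z) + z + d             ≡⟨ cong (_+ d) (m∸n+n≡m z≤d) ⟩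
    d + d                       ≡⟨ cong₂ _+_ (m∸n+n≡m x≤d) (m∸n+n≡m y≤d) ⟨
    (d ∸ x) + x + ((d ∸ y) + y) ≡⟨ interchange (d ∸ x) x (d ∸ y) y ⟩
    (d ∸ x) + (d ∸ y) + (x + y) ∎)
    where open ℕ.≤-Reasoning

module _ {d : ℕ} where

  open SublistCounting (_≟ᶠ_ {d}) public

  ulam+misses≤ : ∀ {π₁ π₂ ρ l₁ l₂ : List (Fin d)} → IsRanking d π₁ → IsRanking d ρ →
    IsCommonSubseq l₁ π₁ ρ → IsCommonSubseq l₂ ρ π₂ →
    ulam d π₁ π₂ + ∑ ρ (λ a → [ a ∉ l₁ ] * [ a ∉ l₂ ]) ≤ (d ∸ length l₁) + (d ∸ length l₂)
  ulam+misses≤ {π₁} {π₂} π₁-ranking ρ-ranking (l₁⊆π₁ , l₁⊆ρ) (l₂⊆ρ , l₂⊆π₂)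
    with common-sublist (ranking⇒unique ρ-ranking) l₁⊆ρ l₂⊆ρ
  ... | m , m⊆l₁ , m⊆l₂ , count =
    ∸-bound (⊆-ranking⇒length≤ ρ-ranking l₁⊆ρ) (⊆-ranking⇒length≤ ρ-ranking l₂⊆ρ)
      (subst (lcsLength π₁ π₂ ≤_) (ranking⇒length≡ π₁-ranking) (lcsLength≤length π₁ π₂))
      (common⇒≤lcsLength (⊆-trans m⊆l₁ l₁⊆π₁ , ⊆-trans m⊆l₂ l₂⊆π₂))
      (trans (cong (_+_ (length m)) (sym (ranking⇒length≡ ρ-ranking))) count)

  ulam-triangle : ∀ {π₁ π₂ : List (Fin d)} π₃ → IsRanking d π₁ → IsRanking d π₂ →
    ulam d π₁ π₃ ≤ ulam d π₁ π₂ + ulam d π₂ π₃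
  ulam-triangle {π₁} {π₂} π₃ π₁-ranking π₂-ranking
    with lcsLength-attained π₁ π₂ | lcsLength-attained π₂ π₃
  ... | l₁ , common₁ , l₁≡ | l₂ , common₂ , l₂≡ = begin
    ulam d π₁ π₃                                          ≤⟨ ℕ.m≤m+n _ _ ⟩
    ulam d π₁ π₃ + ∑ π₂ (λ a → [ a ∉ l₁ ] * [ a ∉ l₂ ])
      ≤⟨ ulam+misses≤ π₁-ranking π₂-ranking common₁ common₂ ⟩
    (d ∸ length l₁) + (d ∸ length l₂)                     ≡⟨ cong₂ (λ x y → (d ∸ x) + (d ∸ y)) l₁≡ l₂≡ ⟩
    ulam d π₁ π₂ + ulam d π₂ π₃                           ∎
    where open ℕ.≤-Reasoning

  ulam+misses≤ulam+ulam : ∀ {π₁ π₂ σ ℓ₁ ℓ₂ : List (Fin d)} → IsRanking d π₁ → IsRanking d σ →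
    IsLCS ℓ₁ π₁ σ → IsLCS ℓ₂ π₂ σ →
    ulam d π₁ π₂ + ∑ σ (λ a → [ a ∉ ℓ₁ ] * [ a ∉ ℓ₂ ]) ≤ ulam d π₁ σ + ulam d π₂ σ
  ulam+misses≤ulam+ulam π₁-ranking σ-ranking lcs₁ lcs₂ = ≤-trans
    (ulam+misses≤ π₁-ranking σ-ranking (proj₁ lcs₁) (swap (proj₁ lcs₂)))
    (≤-reflexive (cong₂ (λ x y → (d ∸ x) + (d ∸ y))
                        (IsLCS⇒length≡lcsLength lcs₁) (IsLCS⇒length≡lcsLength lcs₂)))

ranking? : ∀ d (π : List (Fin d)) → Dec (IsRanking d π)
ranking? d π with unique? _≟ᶠ_ π | all? (λ a → a ∈? π)
  where open DecMembership _≟ᶠ_ using (_∈?_)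
... | yes π-unique | yes all∈π =
  yes (∼bag⇒↭ (unique∧set⇒bag π-unique (allFin⁺ d) (mk⇔ (λ _ → ∈-allFin _) (λ _ → all∈π _))))
... | no π-not-unique | _ = no (λ π-ranking → π-not-unique (ranking⇒unique π-ranking))
... | yes _ | no ¬all∈π = no (λ π-ranking → ¬all∈π (λ a → ∈-resp-↭ (↭-sym π-ranking) (∈-allFin a)))

fair? : ∀ d g grp lam mu k (σ : List (Fin d)) → Dec (IsFair d g grp lam mu k σ)
fair? d g grp lam mu k σ = ranking? d σ ×-dec map′ fromUpTo toUpTo (ℕ.allUpTo? prefixFair? (suc d))
  where
  PrefixFair : ℕ → Set
  PrefixFair p = ∀ i →
    (floor (lam i ℚ.* ℕ→ℚ p) ℤ.≤ + countGroup grp i (take p σ)) ×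
    (+ countGroup grp i (take p σ) ℤ.≤ ceiling (mu i ℚ.* ℕ→ℚ p))
  prefixFair? : ∀ p → Dec (k ≤ p → PrefixFair p)
  prefixFair? p = (k ℕ.≤? p) →-dec all? (λ i → (_ ℤ.≤? _) ×-dec (_ ℤ.≤? _))
  fromUpTo : (∀ {p} → p < suc d → k ≤ p → PrefixFair p) → ∀ p → k ≤ p → p ≤ d → PrefixFair p
  fromUpTo fair p k≤p p≤d = fair (s≤s p≤d) k≤p
  toUpTo : (∀ p → k ≤ p → p ≤ d → PrefixFair p) → ∀ {p} → p < suc d → k ≤ p → PrefixFair p
  toUpTo fair (s≤s p≤d) k≤p = fair _ k≤p p≤d

words : ∀ {A : Set} → List A → ℕ → List (List A)
words alphabet zero = [] ∷ []
words alphabet (suc n) = cartesianProductWith _∷_ alphabet (words alphabet n)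

∈-words : ∀ {A : Set} {alphabet : List A} → (∀ a → a ∈ alphabet) → ∀ w → w ∈ words alphabet (length w)
∈-words all∈ [] = here refl
∈-words all∈ (a ∷ w) = ∈-cartesianProductWith⁺ _∷_ (all∈ a) (∈-words all∈ w)

-- Every ranking is a word of length d over Fin d, so a closest fair ranking is an argmin over a
-- finite list.
closest-fair : ∀ d g grp lam mu k {σ₀ : List (Fin d)} → IsFair d g grp lam mu k σ₀ →
  ∀ π → ∃[ σ ] IsClosestFair d g grp lam mu k π σ
closest-fair d g grp lam mu k {σ₀} σ₀-fair π = σ , σ-fair , σ-closest
  where
  fairRankings = filter (fair? d g grp lam mu k) (words (allFin d) d)
  σ = argmin (ulam d π) σ₀ fairRankings
  σ-fair : IsFair d g grp lam mu k σ
  σ-fair = argmin-all (ulam d π) σ₀-fair (all-filter (fair? d g grp lam mu k) (words (allFin d) d))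
  σ-closest : ∀ τ → IsFair d g grp lam mu k τ → ulam d π σ ≤ ulam d π τ
  σ-closest τ τ-fair = All.lookup (f[argmin]≤f[xs] σ₀ fairRankings)
    (∈-filter⁺ (fair? d g grp lam mu k) τ∈words τ-fair)
    where
    τ∈words : τ ∈ words (allFin d) d
    τ∈words = subst (λ n → τ ∈ words (allFin d) n) (ranking⇒length≡ (proj₁ τ-fair)) (∈-words ∈-allFin τ)

ℕ→ℚ≡mkℚ : ∀ n → ℕ→ℚ n ≡ mkℚ (+ n) 0 (coprime-sym (1-coprimeTo n))
ℕ→ℚ≡mkℚ n = ℚ.normalize-coprime (coprime-sym (1-coprimeTo n))

ℕ→ℚ-+ : ∀ m n → ℕ→ℚ (m + n) ≡ ℕ→ℚ m ℚ.+ ℕ→ℚ n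
ℕ→ℚ-+ m n = trans
  (cong (ℚ._/ 1) (trans (ℤ.pos-+ m n) (sym (cong₂ ℤ._+_ (ℤ.*-identityʳ (+ m)) (ℤ.*-identityʳ (+ n))))))
  (sym (cong₂ ℚ._+_ (ℕ→ℚ≡mkℚ m) (ℕ→ℚ≡mkℚ n)))

ℕ→ℚ-* : ∀ m n → ℕ→ℚ (m * n) ≡ ℕ→ℚ m ℚ.* ℕ→ℚ n
ℕ→ℚ-* m n = trans (cong (ℚ._/ 1) (ℤ.pos-* m n)) (sym (cong₂ ℚ._*_ (ℕ→ℚ≡mkℚ m) (ℕ→ℚ≡mkℚ n)))

ℕ→ℚ-mono-≤ : ∀ {m n} → m ≤ n → ℕ→ℚ m ℚ.≤ ℕ→ℚ n
ℕ→ℚ-mono-≤ {m} {n} m≤n = subst₂ ℚ._≤_ (sym (ℕ→ℚ≡mkℚ m)) (sym (ℕ→ℚ≡mkℚ n))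
  (ℚ.*≤* (subst₂ ℤ._≤_ (sym (ℤ.*-identityʳ (+ m))) (sym (ℤ.*-identityʳ (+ n))) (+≤+ m≤n)))

0≤ℕ→ℚ : ∀ n → 0ℚ ℚ.≤ ℕ→ℚ n
0≤ℕ→ℚ n = ℕ→ℚ-mono-≤ {0} {n} z≤n

0<ℕ→ℚ : ∀ {n} → 1 ≤ n → 0ℚ ℚ.< ℕ→ℚ n
0<ℕ→ℚ {suc n} _ = ℚ.positive⁻¹ (ℕ→ℚ (suc n)) {{subst Positive (sym (ℕ→ℚ≡mkℚ (suc n))) _}}

length-filter*≤∑ : ∀ {A : Set} {P : Pred A 0ℓ} (P? : Decidable P) (g : A → ℕ) {q : ℚ} →
  (∀ {x} → P x → q ℚ.≤ ℕ→ℚ (g x)) → ∀ xs → ℕ→ℚ (length (filter P? xs)) ℚ.* q ℚ.≤ ℕ→ℚ (∑ xs g)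
length-filter*≤∑ P? g {q} P⇒q≤g [] = ℚ.≤-reflexive (ℚ.*-zeroˡ q)
length-filter*≤∑ P? g {q} P⇒q≤g (x ∷ xs) with P? x
... | no _ = ℚ.≤-trans (length-filter*≤∑ P? g P⇒q≤g xs) (ℕ→ℚ-mono-≤ (ℕ.m≤n+m _ (g x)))
... | yes Px = begin
  ℕ→ℚ (suc m) ℚ.* q          ≡⟨ cong (ℚ._* q) (ℕ→ℚ-+ 1 m) ⟩
  (1ℚ ℚ.+ ℕ→ℚ m) ℚ.* q       ≡⟨ solve 2 (λ m q → (con 1ℚ :+ m) :* q := q :+ m :* q) refl (ℕ→ℚ m) q ⟩
  q ℚ.+ ℕ→ℚ m ℚ.* q          ≤⟨ ℚ.+-mono-≤ (P⇒q≤g Px) (length-filter*≤∑ P? g P⇒q≤g xs) ⟩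
  ℕ→ℚ (g x) ℚ.+ ℕ→ℚ (∑ xs g) ≡⟨ ℕ→ℚ-+ (g x) (∑ xs g) ⟨
  ℕ→ℚ (g x + ∑ xs g)         ∎
  where
  open ℚ.≤-Reasoning
  open +-*-Solver
  m = length (filter P? xs)

*-self-mono-≤ : ∀ {p q} → 0ℚ ℚ.≤ p → p ℚ.≤ q → p ℚ.* p ℚ.≤ q ℚ.* q
*-self-mono-≤ {p} {q} 0≤p p≤q = begin
  p ℚ.* p ≤⟨ ℚ.*-monoˡ-≤-nonNeg p {{ℚ.nonNegative 0≤p}} p≤q ⟩
  p ℚ.* q ≤⟨ ℚ.*-monoʳ-≤-nonNeg q {{ℚ.nonNegative (ℚ.≤-trans 0≤p p≤q)}} p≤q ⟩
  q ℚ.* q ∎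
  where open ℚ.≤-Reasoning

three : ℚ
three = ℕ→ℚ 3

approximation-bound : ∀ {n c o x : ℕ} {a α β : ℚ} → 1 ≤ n → 0ℚ ℚ.≤ α →
  n * c + x ≤ 3 * (n * o) → β ℚ.* ℕ→ℚ o ℚ.≤ a ℚ.* ℕ→ℚ n →
  a ℚ.* ((α ℚ.* ℕ→ℚ n) ℚ.* (α ℚ.* ℕ→ℚ n)) ℚ.≤ ℕ→ℚ x →
  ℕ→ℚ c ℚ.≤ (three ℚ.- α ℚ.* α ℚ.* β) ℚ.* ℕ→ℚ o
approximation-bound {n} {c} {o} {x} {a} {α} {β} n≥1 0≤α nc+x≤3no βo≤an x≥ = begin
  C                               ≡⟨ solve 2 (λ c y → c := (c :+ y) :- y) refl C (δ ℚ.* O) ⟩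
  (C ℚ.+ δ ℚ.* O) ℚ.- δ ℚ.* O     ≤⟨ ℚ.+-monoˡ-≤ (ℚ.- (δ ℚ.* O)) (ℚ.*-cancelˡ-≤-pos N {{N-pos}} N[C+δO]≤) ⟩
  three ℚ.* O ℚ.- δ ℚ.* O         ≡⟨ solve 3 (λ t d o → t :* o :- d :* o := (t :- d) :* o) refl three δ O ⟩
  (three ℚ.- δ) ℚ.* O             ∎
  where
  open ℚ.≤-Reasoning
  open +-*-Solver
  N = ℕ→ℚ n
  C = ℕ→ℚ c
  O = ℕ→ℚ o
  δ = α ℚ.* α ℚ.* β
  r = α ℚ.* α ℚ.* N
  N-pos : ℚ.Positive N
  N-pos = ℚ.positive (0<ℕ→ℚ n≥1)
  NC+X≤3NO : N ℚ.* C ℚ.+ ℕ→ℚ x ℚ.≤ three ℚ.* (N ℚ.* O)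
  NC+X≤3NO = subst₂ ℚ._≤_
    (trans (ℕ→ℚ-+ (n * c) x) (cong (ℚ._+ ℕ→ℚ x) (ℕ→ℚ-* n c)))
    (trans (ℕ→ℚ-* 3 (n * o)) (cong (three ℚ.*_) (ℕ→ℚ-* n o)))
    (ℕ→ℚ-mono-≤ nc+x≤3no)
  instance
    r-nonNeg : ℚ.NonNegative r
    r-nonNeg =
      ℚ.nonNeg*nonNeg⇒nonNeg (α ℚ.* α) {{ℚ.nonNeg*nonNeg⇒nonNeg α α}} N {{ℚ.pos⇒nonNeg N {{N-pos}}}}
      where
      instance
        α-nonNeg : ℚ.NonNegative α
        α-nonNeg = ℚ.nonNegative 0≤α
  N[C+δO]≤ : N ℚ.* (C ℚ.+ δ ℚ.* O) ℚ.≤ N ℚ.* (three ℚ.* O)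
  N[C+δO]≤ = begin
    N ℚ.* (C ℚ.+ δ ℚ.* O)
      ≡⟨ solve 5 (λ n c o α β → n :* (c :+ α :* α :* β :* o) := n :* c :+ (α :* α :* n) :* (β :* o))
               refl N C O α β ⟩
    N ℚ.* C ℚ.+ r ℚ.* (β ℚ.* O)
      ≤⟨ ℚ.+-monoʳ-≤ (N ℚ.* C) (ℚ.*-monoˡ-≤-nonNeg r βo≤an) ⟩
    N ℚ.* C ℚ.+ r ℚ.* (a ℚ.* N)
      ≡⟨ cong (ℚ._+_ (N ℚ.* C))
              (solve 3 (λ α n a → (α :* α :* n) :* (a :* n) := a :* ((α :* n) :* (α :* n))) refl α N a) ⟩
    N ℚ.* C ℚ.+ a ℚ.* ((α ℚ.* N) ℚ.* (α ℚ.* N))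
      ≤⟨ ℚ.+-monoʳ-≤ (N ℚ.* C) x≥ ⟩
    N ℚ.* C ℚ.+ ℕ→ℚ x
      ≤⟨ NC+X≤3NO ⟩
    three ℚ.* (N ℚ.* O)
      ≡⟨ solve 3 (λ t n o → t :* (n :* o) := n :* (t :* o)) refl three N O ⟩
    N ℚ.* (three ℚ.* O) ∎

module FairMedianBound (d g : ℕ) (grp : Fin d → Fin g) (lam mu : Fin g → ℚ) (k : ℕ)
  (S : List (List (Fin d))) (S-rankings : All (IsRanking d) S)
  (σ* : List (Fin d)) (σ*-median : IsFairMedian d g grp lam mu k S σ*)
  (ℓ : List (Fin d) → List (Fin d)) (ℓ-lcs : ∀ π → π ∈ S → IsLCS (ℓ π) π σ*) where

  σ*-fair : IsFair d g grp lam mu k σ*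
  σ*-fair = proj₁ σ*-median

  σ*-ranking : IsRanking d σ*
  σ*-ranking = proj₁ σ*-fair

  σᶠ : List (Fin d) → List (Fin d)
  σᶠ π = proj₁ (closest-fair d g grp lam mu k σ*-fair π)

  σᶠ-closest : ∀ π → IsClosestFair d g grp lam mu k π (σᶠ π)
  σᶠ-closest π = proj₂ (closest-fair d g grp lam mu k σ*-fair π)

  cost : Fin d → ℕ
  cost = symCost S ℓ

  totalCost-σᶠ≤ : ∀ {π} → π ∈ S → totalCost d S (σᶠ π) ≤ ∑ S (λ π′ → ulam d π′ π + ulam d π σ*)
  totalCost-σᶠ≤ {π} π∈S = ∑-mono-≤ S (λ π′∈S → ℕ.≤-trans
    (ulam-triangle (σᶠ π) (All.lookup S-rankings π′∈S) (All.lookup S-rankings π∈S))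
    (ℕ.+-monoʳ-≤ _ (proj₂ (σᶠ-closest π) σ* σ*-fair)))

  jointMisses : List (Fin d) → List (Fin d) → ℕ
  jointMisses π′ π = ∑ σ* (λ a → [ a ∉ ℓ π′ ] * [ a ∉ ℓ π ])

  ∑∑jointMisses≡∑cost² : ∑ S (λ π → ∑ S (λ π′ → jointMisses π′ π)) ≡ ∑ (allFin d) (λ a → cost a * cost a)
  ∑∑jointMisses≡∑cost² = begin
    ∑ S (λ π → ∑ S (λ π′ → jointMisses π′ π))
      ≡⟨ ∑∑∑≡∑-square S σ* (λ a π → [ a ∉ ℓ π ]) ⟩
    ∑ σ* (λ a → ∑ S (λ π → [ a ∉ ℓ π ]) * ∑ S (λ π → [ a ∉ ℓ π ]))
      ≡⟨ ∑-cong σ* (λ a → cong (λ c → c * c) (sym (cost≡ a))) ⟩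
    ∑ σ* (λ a → cost a * cost a)
      ≡⟨ ∑-↭ (λ a → cost a * cost a) σ*-ranking ⟩
    ∑ (allFin d) (λ a → cost a * cost a) ∎
    where
    open ≡-Reasoning
    cost≡ : ∀ a → cost a ≡ ∑ S (λ π → [ a ∉ ℓ π ])
    cost≡ a = length-filter≡∑𝟙 _ S

  ∑totalCost-σᶠ+∑cost²≤ : ∑ S (λ π → totalCost d S (σᶠ π)) + ∑ (allFin d) (λ a → cost a * cost a)
                            ≤ 3 * (length S * totalCost d S σ*)
  ∑totalCost-σᶠ+∑cost²≤ = begin
    ∑ S (λ π → totalCost d S (σᶠ π)) + ∑ (allFin d) (λ a → cost a * cost a)
      ≡⟨ cong (_+_ (∑ S (λ π → totalCost d S (σᶠ π)))) ∑∑jointMisses≡∑cost² ⟨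
    ∑ S (λ π → totalCost d S (σᶠ π)) + ∑ S (λ π → ∑ S (λ π′ → jointMisses π′ π))
      ≤⟨ ℕ.+-monoˡ-≤ _ (∑-mono-≤ S totalCost-σᶠ≤) ⟩
    ∑ S (λ π → ∑ S (λ π′ → ulam d π′ π + u π)) + ∑ S (λ π → ∑ S (λ π′ → jointMisses π′ π))
      ≡⟨ ∑-distrib-+ S _ _ ⟨
    ∑ S (λ π → ∑ S (λ π′ → ulam d π′ π + u π) + ∑ S (λ π′ → jointMisses π′ π))
      ≡⟨ ∑-cong S (λ π → sym (∑-distrib-+ S _ _)) ⟩
    ∑ S (λ π → ∑ S (λ π′ → ulam d π′ π + u π + jointMisses π′ π))
      ≤⟨ ∑-mono-≤ S (λ π∈S → ∑-mono-≤ S (λ π′∈S → pair-bound π∈S π′∈S)) ⟩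
    ∑ S (λ π → ∑ S (λ π′ → u π′ + u π + u π))
      ≡⟨ ∑∑[fy+fx+fx]≡3n∑f S u ⟩
    3 * (length S * totalCost d S σ*) ∎
    where
    open ℕ.≤-Reasoning
    u : List (Fin d) → ℕ
    u π = ulam d π σ*
    pair-bound : ∀ {π π′} → π ∈ S → π′ ∈ S → ulam d π′ π + u π + jointMisses π′ π ≤ u π′ + u π + u π
    pair-bound {π} {π′} π∈S π′∈S = begin
      ulam d π′ π + u π + jointMisses π′ π ≡⟨ xy∙z≈xz∙y (ulam d π′ π) (u π) (jointMisses π′ π) ⟩
      ulam d π′ π + jointMisses π′ π + u π ≤⟨ ℕ.+-monoˡ-≤ (u π)
        (ulam+misses≤ulam+ulam (All.lookup S-rankings π′∈S) σ*-ranking (ℓ-lcs π′ π′∈S) (ℓ-lcs π π∈S)) ⟩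
      u π′ + u π + u π                 ∎

  fair-approximation : (α β : ℚ) → 0ℚ ℚ.≤ α → 1 ≤ length S →
    β ℚ.* ℕ→ℚ (totalCost d S σ*) ℚ.≤ ℕ→ℚ (length (activeSymbols d α S ℓ)) ℚ.* ℕ→ℚ (length S) →
    ∃[ σ ] (InSf d g grp lam mu k S σ ×
            ℕ→ℚ (totalCost d S σ) ℚ.≤ (three ℚ.- α ℚ.* α ℚ.* β) ℚ.* ℕ→ℚ (totalCost d S σ*))
  fair-approximation α β 0≤α n≥1 A-large =
    σᶠ π* , (π* , π*∈S , σᶠ-closest π*) ,
    approximation-bound {a = ℕ→ℚ (length (activeSymbols d α S ℓ))} n≥1 0≤α combined A-large ∑cost²-large
    where
    n = length S
    best = min≤mean (λ π → totalCost d S (σᶠ π)) S n≥1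
    π* = proj₁ best
    π*∈S = proj₁ (proj₂ best)
    X = ∑ (allFin d) (λ a → cost a * cost a)
    combined : n * totalCost d S (σᶠ π*) + X ≤ 3 * (n * totalCost d S σ*)
    combined = ℕ.≤-trans (ℕ.+-monoˡ-≤ X (proj₂ (proj₂ best))) ∑totalCost-σᶠ+∑cost²≤
    0≤αn : 0ℚ ℚ.≤ α ℚ.* ℕ→ℚ n
    0≤αn = ℚ.nonNegative⁻¹ _
      {{ℚ.nonNeg*nonNeg⇒nonNeg α {{ℚ.nonNegative 0≤α}} (ℕ→ℚ n) {{ℚ.nonNegative (0≤ℕ→ℚ n)}}}}
    ∑cost²-large : ℕ→ℚ (length (activeSymbols d α S ℓ)) ℚ.* ((α ℚ.* ℕ→ℚ n) ℚ.* (α ℚ.* ℕ→ℚ n)) ℚ.≤ ℕ→ℚ X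
    ∑cost²-large = length-filter*≤∑ (λ a → (α ℚ.* ℕ→ℚ n) ℚ.<? ℕ→ℚ (cost a)) (λ a → cost a * cost a)
                                    active⇒large (allFin d)
      where
      active⇒large : ∀ {a} → α ℚ.* ℕ→ℚ n ℚ.< ℕ→ℚ (cost a) →
                     (α ℚ.* ℕ→ℚ n) ℚ.* (α ℚ.* ℕ→ℚ n) ℚ.≤ ℕ→ℚ (cost a * cost a)
      active⇒large {a} αn<cost = ℚ.≤-trans (*-self-mono-≤ 0≤αn (ℚ.<⇒≤ αn<cost))
                                            (ℚ.≤-reflexive (sym (ℕ→ℚ-* (cost a) (cost a))))

lemma5 : (α β : ℚ) → 0ℚ ℚ.< α → α ℚ.≤ (+ 1) ℚ./ 10 → 0ℚ ℚ.< β → β ℚ.< 1ℚ →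
  ∃[ δ ] (0ℚ ℚ.< δ ×
    (∀ (d g : ℕ) (grp : Fin d → Fin g) (lam mu : Fin g → ℚ) (k : ℕ) →
      (∀ i → ∃[ a ] grp a ≡ i) →
      (∀ i → (0ℚ ℚ.≤ lam i × lam i ℚ.≤ 1ℚ) × (0ℚ ℚ.≤ mu i × mu i ℚ.≤ 1ℚ)) →
      1 ℕ.≤ k → k ℕ.≤ d →
      (∃[ τ ] IsFair d g grp lam mu k τ) →
      ∀ (S : List (List (Fin d))) → Unique S → All (IsRanking d) S → 1 ℕ.≤ length S →
      ∀ (σ* : List (Fin d)) → IsFairMedian d g grp lam mu k S σ* →
      ∀ (ℓ : List (Fin d) → List (Fin d)) → (∀ π → π ∈ S → IsLCS (ℓ π) π σ*) →
      β ℚ.* ℕ→ℚ (totalCost d S σ*)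
        ℚ.≤ ℕ→ℚ (length (activeSymbols d α S ℓ)) ℚ.* ℕ→ℚ (length S) →
      ∃[ σ~ ] (InSf d g grp lam mu k S σ~ ×
        ℕ→ℚ (totalCost d S σ~) ℚ.≤ ((+ 3) ℚ./ 1 ℚ.- δ) ℚ.* ℕ→ℚ (totalCost d S σ*))))
lemma5 α β 0<α _ 0<β _ = α ℚ.* α ℚ.* β , 0<δ ,
  λ d g grp lam mu k _ _ _ _ _ S _ S-rankings n≥1 σ* σ*-median ℓ ℓ-lcs A-large →
    FairMedianBound.fair-approximation d g grp lam mu k S S-rankings σ* σ*-median ℓ ℓ-lcs
      α β (ℚ.<⇒≤ 0<α) n≥1 A-large
  where
  instance
    α-pos : ℚ.Positive α
    α-pos = ℚ.positive 0<α
    β-pos : ℚ.Positive β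
    β-pos = ℚ.positive 0<β
  0<δ : 0ℚ ℚ.< α ℚ.* α ℚ.* β
  0<δ = ℚ.positive⁻¹ _ {{ℚ.pos*pos⇒pos (α ℚ.* α) {{ℚ.pos*pos⇒pos α α}} β}}
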